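{- For every integer $t\geq 1$, $\operatorname{BR}_t^1(\bowtie)=2t+1$.
   Context: The butterfly poset $\bowtie$ has elements $x_1,x_2,y_1,y_2$ with $x_i\le y_j$ for all $i,j\in\{1,2\}$ and no other relations. $B_n$ is the Boolean lattice of subsets of $[n]$. A copy of a poset $P$ in a poset $Q$ is the image of an injection $f:P\to Q$ with $f(x)\le f(y)$ whenever $x\le y$. $\operatorname{BR}_t^1(P)$ is the least $N$ such that every coloring of the elements of $B_N$ with $t$ colors contains a copy of $P$ all of whose elements have the same color. -}

module Defs where

open import Data.Nat using (ℕ; _≤_)
open import Data.Fin using (Fin)
open import Data.Fin.Subset using (Subset; _⊆_)
open import Data.Product using (Σ; ∃; _×_)
open import Relation.Binary.PropositionalEquality using (_≡_)
open import Function.Definitions using (Injective)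

data Bfly : Set where
  x₁ x₂ y₁ y₂ : Bfly

data _≤⋈_ : Bfly → Bfly → Set where
  ≤-refl : ∀ {a} → a ≤⋈ a
  x₁y₁ : x₁ ≤⋈ y₁
  x₁y₂ : x₁ ≤⋈ y₂
  x₂y₁ : x₂ ≤⋈ y₁
  x₂y₂ : x₂ ≤⋈ y₂

IsCopy : ∀ {n} → (Bfly → Subset n) → Set
IsCopy f = Injective _≡_ _≡_ f × (∀ {a b} → a ≤⋈ b → f a ⊆ f b)

HasMonoCopy : ∀ {n t} → (Subset n → Fin t) → Set
HasMonoCopy {n} {t} c =
  Σ (Bfly → Subset n) λ f → IsCopy f × ∃ λ (k : Fin t) → ∀ a → c (f a) ≡ k

BRProp : ℕ → ℕ → Set
BRProp t N = (c : Subset N → Fin t) → HasMonoCopy c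

BR-is : ℕ → ℕ → Set
BR-is t m = BRProp t m × (∀ N → BRProp t N → m ≤ N)

-- Listing ∅, then {0,…,k-2,k} and {0,…,k-1} for k = 1,…,n-1, then [n] gives
-- 2n sets of B_n any five of which contain a butterfly: the top two serve as y₁ and y₂, the
-- lowest as x₁, and as x₂ the third if it is an initial segment {0,…,k-1}, otherwise the
-- second.  For n = 2t+1 there are 4t+2 > 4t such sets, so some colour class contains five.
--
-- For n ≤ 2t colour the full set 0 and every other set S by ⌊|S|/2⌋.  Below the
-- top level each colour class spans two adjacent levels, so a monochromatic butterfly there
-- has both xᵢ of some size m and both yⱼ of size m+1, and then x₁ = x₂ or y₁ = y₂.  If just
-- one yⱼ is the full set the colour is 0, which makes both xᵢ empty.

module Submission where

open import Defs
open import Data.Nat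
  using (ℕ; zero; suc; _≤_; _<_; _>_; _+_; _*_; z≤n; s≤s; z<s; s<s; _≟_; _<?_; _≤?_; ⌊_/2⌋; parity)
import Data.Nat.Properties as ℕ
open import Data.Nat.Tactic.RingSolver using (solve-∀)
open import Data.Parity.Base using (0ℙ; 1ℙ)
open import Data.Bool using (true; false)
open import Data.Fin using (Fin; toℕ; fromℕ<)
open import Data.Fin.Properties using (toℕ-injective; toℕ<n; toℕ-fromℕ<)
open import Data.Fin.Subset using (Subset; _⊆_; _∩_; ∣_∣; ⊥; ⊤; inside; outside)
open import Data.Fin.Subset.Properties
  using (drop-∷-⊆; p⊆q⇒∣p∣≤∣q∣; ⊆-refl; ⊥⊆; ∣⊥∣≡0; ∣p∣≤n; ∣p∣≡n⇒p≡⊤; p∩q⊆p; p∩q⊆q; x∈p∩q⁺; out⊆; s⊆s)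
open import Data.Vec using ([]; _∷_; here)
open import Data.Vec.Properties using (∷-injectiveʳ)
open import Data.List using ([]; _∷_; length; filter; downFrom)
open import Data.List.Properties using (length-downFrom)
open import Data.List.Relation.Unary.All using (All; _∷_; zipWith)
import Data.List.Relation.Unary.All.Properties as All
open import Data.List.Relation.Unary.AllPairs using (AllPairs; _∷_)
import Data.List.Relation.Unary.AllPairs.Properties as AllPairs
open import Data.Product using (Σ; ∃; _×_; _,_; proj₁; proj₂; map₂)
open import Data.Sum using (_⊎_; inj₁; inj₂; [_,_])
open import Function using (_∘_; id)
open import Function.Definitions using (Injective)
open import Level using (Level)
open import Relation.Binary.Core using (Rel)
open import Relation.Binary.Definitions using (Reflexive)
open import Relation.Binary.PropositionalEquality using (_≡_; _≢_; refl; sym; trans; cong; subst)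
open import Relation.Nullary using (¬_; yes; no; does; contradiction)
open import Relation.Unary using (Pred; Decidable)
open import Relation.Unary.Properties using (∁?)

private
  variable
    a ℓ : Level
    A : Set a
    m n t : ℕ
    p q r s : Subset n

p⊆q∧∣q∣≤∣p∣⇒p≡q : p ⊆ q → ∣ q ∣ ≤ ∣ p ∣ → p ≡ q
p⊆q∧∣q∣≤∣p∣⇒p≡q {p = []}          {[]}          _   _ = refl
p⊆q∧∣q∣≤∣p∣⇒p≡q {p = outside ∷ p} {outside ∷ q} p⊆q ∣q∣≤∣p∣ =
  cong (outside ∷_) (p⊆q∧∣q∣≤∣p∣⇒p≡q (drop-∷-⊆ p⊆q) ∣q∣≤∣p∣)
p⊆q∧∣q∣≤∣p∣⇒p≡q {p = outside ∷ p} {inside  ∷ q} p⊆q ∣q∣≤∣p∣ =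
  contradiction ∣q∣≤∣p∣ (ℕ.<⇒≱ (s≤s (p⊆q⇒∣p∣≤∣q∣ (drop-∷-⊆ p⊆q))))
p⊆q∧∣q∣≤∣p∣⇒p≡q {p = inside  ∷ p} {outside ∷ q} p⊆q _ = contradiction (p⊆q here) λ ()
p⊆q∧∣q∣≤∣p∣⇒p≡q {p = inside  ∷ p} {inside  ∷ q} p⊆q ∣q∣≤∣p∣ =
  cong (inside ∷_) (p⊆q∧∣q∣≤∣p∣⇒p≡q (drop-∷-⊆ p⊆q) (ℕ.≤-pred ∣q∣≤∣p∣))

p⊆q∧p≢q⇒∣p∣<∣q∣ : p ⊆ q → p ≢ q → ∣ p ∣ < ∣ q ∣
p⊆q∧p≢q⇒∣p∣<∣q∣ p⊆q p≢q =
  ℕ.≤∧≢⇒< (p⊆q⇒∣p∣≤∣q∣ p⊆q) (p≢q ∘ p⊆q∧∣q∣≤∣p∣⇒p≡q p⊆q ∘ ℕ.≤-reflexive ∘ sym)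

∣p∣≡0⇒p≡⊥ : ∀ {n} {p : Subset n} → ∣ p ∣ ≡ 0 → p ≡ ⊥
∣p∣≡0⇒p≡⊥ {n = n} ∣p∣≡0 = sym (p⊆q∧∣q∣≤∣p∣⇒p≡q ⊥⊆ (ℕ.≤-reflexive (trans ∣p∣≡0 (sym (∣⊥∣≡0 n)))))

-- If r ≢ s then r ∩ s has at most m elements, so it equals both p and q.
⊆-adjacent-levels : p ⊆ r → p ⊆ s → q ⊆ r → q ⊆ s →
                    ∣ p ∣ ≡ m → ∣ q ∣ ≡ m → ∣ r ∣ ≡ suc m → ∣ s ∣ ≡ suc m →
                    p ≡ q ⊎ r ≡ s
⊆-adjacent-levels {r = r} {s = s} {m = m} p⊆r p⊆s q⊆r q⊆s ∣p∣≡m ∣q∣≡m ∣r∣≡1+m ∣s∣≡1+m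
  with ∣ r ∩ s ∣ ≤? m
... | yes ∣r∩s∣≤m = inj₁ (trans (≡r∩s p⊆r p⊆s ∣p∣≡m) (sym (≡r∩s q⊆r q⊆s ∣q∣≡m)))
  where
  ≡r∩s : ∀ {u} → u ⊆ r → u ⊆ s → ∣ u ∣ ≡ m → u ≡ r ∩ s
  ≡r∩s u⊆r u⊆s ∣u∣≡m = p⊆q∧∣q∣≤∣p∣⇒p≡q (λ x∈u → x∈p∩q⁺ (u⊆r x∈u , u⊆s x∈u))
                                        (ℕ.≤-trans ∣r∩s∣≤m (ℕ.≤-reflexive (sym ∣u∣≡m)))
... | no ∣r∩s∣≰m = inj₂ (trans (sym (r∩s≡ (p∩q⊆p r s) ∣r∣≡1+m)) (r∩s≡ (p∩q⊆q r s) ∣s∣≡1+m))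
  where
  r∩s≡ : ∀ {u} → r ∩ s ⊆ u → ∣ u ∣ ≡ suc m → r ∩ s ≡ u
  r∩s≡ r∩s⊆u ∣u∣≡1+m = p⊆q∧∣q∣≤∣p∣⇒p≡q r∩s⊆u (subst (_≤ ∣ r ∩ s ∣) (sym ∣u∣≡1+m) (ℕ.≰⇒> ∣r∩s∣≰m))

IsCopy⇒∣<∣ : ∀ {f : Bfly → Subset n} → IsCopy f → ∀ {u v} → u ≤⋈ v → u ≢ v → ∣ f u ∣ < ∣ f v ∣
IsCopy⇒∣<∣ (injective , monotone) u≤v u≢v = p⊆q∧p≢q⇒∣p∣<∣q∣ (monotone u≤v) (u≢v ∘ injective)

⋈-map : A → A → A → A → Bfly → A
⋈-map a₁ a₂ b₁ b₂ x₁ = a₁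
⋈-map a₁ a₂ b₁ b₂ x₂ = a₂
⋈-map a₁ a₂ b₁ b₂ y₁ = b₁
⋈-map a₁ a₂ b₁ b₂ y₂ = b₂

module _ {a₁ a₂ b₁ b₂ : A} where

  ⋈-map-∀ : ∀ {P : Pred A ℓ} → P a₁ → P a₂ → P b₁ → P b₂ → ∀ u → P (⋈-map a₁ a₂ b₁ b₂ u)
  ⋈-map-∀ Pa₁ Pa₂ Pb₁ Pb₂ x₁ = Pa₁
  ⋈-map-∀ Pa₁ Pa₂ Pb₁ Pb₂ x₂ = Pa₂
  ⋈-map-∀ Pa₁ Pa₂ Pb₁ Pb₂ y₁ = Pb₁
  ⋈-map-∀ Pa₁ Pa₂ Pb₁ Pb₂ y₂ = Pb₂

  ⋈-map-monotone : ∀ {_≼_ : Rel A ℓ} → Reflexive _≼_ →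
                   a₁ ≼ b₁ → a₁ ≼ b₂ → a₂ ≼ b₁ → a₂ ≼ b₂ →
                   ∀ {u v} → u ≤⋈ v → ⋈-map a₁ a₂ b₁ b₂ u ≼ ⋈-map a₁ a₂ b₁ b₂ v
  ⋈-map-monotone refl′ _ _ _ _ ≤-refl = refl′
  ⋈-map-monotone _ a₁≼b₁ _ _ _ x₁y₁ = a₁≼b₁
  ⋈-map-monotone _ _ a₁≼b₂ _ _ x₁y₂ = a₁≼b₂
  ⋈-map-monotone _ _ _ a₂≼b₁ _ x₂y₁ = a₂≼b₁
  ⋈-map-monotone _ _ _ _ a₂≼b₂ x₂y₂ = a₂≼b₂

  ⋈-map-injective : a₁ ≢ a₂ → a₁ ≢ b₁ → a₁ ≢ b₂ → a₂ ≢ b₁ → a₂ ≢ b₂ → b₁ ≢ b₂ →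
                    Injective _≡_ _≡_ (⋈-map a₁ a₂ b₁ b₂)
  ⋈-map-injective _ _ _ _ _ _ {x₁} {x₁} _ = refl
  ⋈-map-injective _ _ _ _ _ _ {x₂} {x₂} _ = refl
  ⋈-map-injective _ _ _ _ _ _ {y₁} {y₁} _ = refl
  ⋈-map-injective _ _ _ _ _ _ {y₂} {y₂} _ = refl
  ⋈-map-injective ≢₁₂ _ _ _ _ _ {x₁} {x₂} e = contradiction e ≢₁₂
  ⋈-map-injective ≢₁₂ _ _ _ _ _ {x₂} {x₁} e = contradiction (sym e) ≢₁₂
  ⋈-map-injective _ ≢₁₃ _ _ _ _ {x₁} {y₁} e = contradiction e ≢₁₃
  ⋈-map-injective _ ≢₁₃ _ _ _ _ {y₁} {x₁} e = contradiction (sym e) ≢₁₃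
  ⋈-map-injective _ _ ≢₁₄ _ _ _ {x₁} {y₂} e = contradiction e ≢₁₄
  ⋈-map-injective _ _ ≢₁₄ _ _ _ {y₂} {x₁} e = contradiction (sym e) ≢₁₄
  ⋈-map-injective _ _ _ ≢₂₃ _ _ {x₂} {y₁} e = contradiction e ≢₂₃
  ⋈-map-injective _ _ _ ≢₂₃ _ _ {y₁} {x₂} e = contradiction (sym e) ≢₂₃
  ⋈-map-injective _ _ _ _ ≢₂₄ _ {x₂} {y₂} e = contradiction e ≢₂₄
  ⋈-map-injective _ _ _ _ ≢₂₄ _ {y₂} {x₂} e = contradiction (sym e) ≢₂₄
  ⋈-map-injective _ _ _ _ _ ≢₃₄ {y₁} {y₂} e = contradiction e ≢₃₄
  ⋈-map-injective _ _ _ _ _ ≢₃₄ {y₂} {y₁} e = contradiction (sym e) ≢₃₄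

⋈-swap : Bfly → Bfly
⋈-swap y₁ = y₂
⋈-swap y₂ = y₁
⋈-swap u = u

⋈-swap-involutive : ∀ u → ⋈-swap (⋈-swap u) ≡ u
⋈-swap-involutive x₁ = refl
⋈-swap-involutive x₂ = refl
⋈-swap-involutive y₁ = refl
⋈-swap-involutive y₂ = refl

⋈-swap-monotone : ∀ {u v} → u ≤⋈ v → ⋈-swap u ≤⋈ ⋈-swap v
⋈-swap-monotone ≤-refl = ≤-refl
⋈-swap-monotone x₁y₁ = x₁y₂
⋈-swap-monotone x₁y₂ = x₁y₁
⋈-swap-monotone x₂y₁ = x₂y₂
⋈-swap-monotone x₂y₂ = x₂y₁

IsCopy-∘-⋈-swap : ∀ {f : Bfly → Subset n} → IsCopy f → IsCopy (f ∘ ⋈-swap)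
IsCopy-∘-⋈-swap (injective , monotone) =
  (λ {u} {v} e → trans (sym (⋈-swap-involutive u))
                       (trans (cong ⋈-swap (injective e)) (⋈-swap-involutive v))) ,
  monotone ∘ ⋈-swap-monotone

HasCopyIn : (Subset n → Set) → Set
HasCopyIn {n} P = Σ (Bfly → Subset n) λ f → IsCopy f × ∀ u → P (f u)

module _ {P : Pred A ℓ} (P? : Decidable P) where

  length-filter+length-filter-∁ : ∀ xs → length (filter P? xs) + length (filter (∁? P?) xs) ≡ length xs
  length-filter+length-filter-∁ [] = refl
  length-filter+length-filter-∁ (x ∷ xs) with does (P? x)
  ... | true  = cong suc (length-filter+length-filter-∁ xs)
  ... | false = trans (ℕ.+-suc _ _) (cong suc (length-filter+length-filter-∁ xs))

  length-filter-filter : ∀ {Q : Pred A ℓ} (Q? : Decidable Q) xs →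
                         length (filter P? (filter Q? xs)) ≤ length (filter P? xs)
  length-filter-filter Q? [] = z≤n
  length-filter-filter Q? (x ∷ xs) with does (Q? x)
  ... | true  with does (P? x)
  ...   | true  = s≤s (length-filter-filter Q? xs)
  ...   | false = length-filter-filter Q? xs
  length-filter-filter Q? (x ∷ xs) | false with does (P? x)
  ...   | true  = ℕ.m≤n⇒m≤1+n (length-filter-filter Q? xs)
  ...   | false = length-filter-filter Q? xs

pigeonhole : ∀ r (colour : A → ℕ) xs → All (λ x → colour x < t) xs → t * r < length xs →
             ∃ λ k → r < length (filter (λ x → colour x ≟ k) xs)
pigeonhole {t = zero}  r colour []       _            ()
pigeonhole {t = zero}  r colour (x ∷ xs) (() ∷ _)     _
pigeonhole {t = suc t} r colour xs       bounded      long
  with r <? length (filter (λ x → colour x ≟ t) xs)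
... | yes many = t , many
... | no  few  =
  map₂ (λ {k} many → ℕ.<-≤-trans many (length-filter-filter (λ x → colour x ≟ k) (∁? has-t?) xs))
       (pigeonhole r colour others others-bounded others-long)
  where
  has-t? = λ x → colour x ≟ t
  others = filter (∁? has-t?) xs
  others-bounded : All (λ x → colour x < t) others
  others-bounded = zipWith (λ (x<1+t , x≢t) → ℕ.≤∧≢⇒< (ℕ.≤-pred x<1+t) x≢t)
                           (All.filter⁺ _ bounded , All.all-filter (∁? has-t?) xs)
  others-long : t * r < length others
  others-long = ℕ.+-cancelˡ-< r (t * r) (length others) (ℕ.<-≤-trans
    (subst (r + t * r <_) (sym (length-filter+length-filter-∁ has-t? xs)) long)
    (ℕ.+-monoˡ-≤ (length others) (ℕ.≮⇒≥ few)))

-- Positions 0, 1, 2, 3, 4, … carry ∅, {1}, {0}, {0,2}, {0,1}, …: position 2k is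
-- {0,…,k-1}, position 2k-1 is {0,…,k-2,k}, except that position 2n-1 is the full set.
ladder : (n : ℕ) → ℕ → Subset n
ladder n             zero          = ⊥
ladder zero          (suc e)       = []
ladder (suc n)       (suc (suc e)) = inside ∷ ladder n e
ladder (suc zero)    (suc zero)    = ⊤
ladder (suc (suc n)) (suc zero)    = outside ∷ inside ∷ ⊥

ladder-injective : ∀ {a b} → a < b → b < 2 * n → ladder n a ≢ ladder n b
ladder-injective {zero}                                  _            ()
ladder-injective {suc _}       {suc _}    {suc zero}     (s≤s ())     _
ladder-injective {suc zero}    {zero}     {suc zero}     _            _    ()
ladder-injective {suc (suc n)} {zero}     {suc zero}     _            _    ()
ladder-injective {suc n}       {zero}     {suc (suc b)}  _            _    ()
ladder-injective {suc zero}    {suc zero} {suc (suc b)}  _            (s≤s (s≤s ()))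
ladder-injective {suc (suc n)} {suc zero} {suc (suc b)}  _            _    ()
ladder-injective {suc n} {suc (suc a)} {suc (suc b)} (s≤s (s≤s a<b)) 2+b<2+2n e =
  ladder-injective a<b (ℕ.+-cancelˡ-< 2 b (2 * n) (subst (2 + b <_) (ℕ.*-suc 2 n) 2+b<2+2n))
                   (∷-injectiveʳ e)

ladder-even-⊆ : ∀ {a b} → parity a ≡ 0ℙ → a < b → ladder n a ⊆ ladder n b
ladder-even-⊆ {a = zero}                   _    _                 = ⊥⊆
ladder-even-⊆ {zero}    {suc (suc a)}      _    (s≤s (s≤s _))     = ⊆-refl
ladder-even-⊆ {suc n}   {suc (suc a)}      even (s≤s (s≤s a<b))   = s⊆s (ladder-even-⊆ even a<b)

ladder-gap-⊆ : ∀ {a b} → 3 + a ≤ b → ladder n a ⊆ ladder n b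
ladder-gap-⊆ {a = zero}                    _                           = ⊥⊆
ladder-gap-⊆ {zero}          {suc a}       (s≤s _)                     = ⊆-refl
ladder-gap-⊆ {suc zero}      {suc zero}    (s≤s (s≤s (s≤s (s≤s _))))   = ⊆-refl
ladder-gap-⊆ {suc (suc n)}   {suc zero}    (s≤s (s≤s (s≤s (s≤s _))))   = out⊆ (s⊆s ⊥⊆)
ladder-gap-⊆ {suc n}         {suc (suc a)} (s≤s (s≤s 3+a≤b))           = s⊆s (ladder-gap-⊆ 3+a≤b)

_◃_ : ℕ → ℕ → Set
a ◃ b = a < b × (parity a ≡ 0ℙ ⊎ 3 + a ≤ b)

ladder-◃-⊆ : ∀ {a b} → a ◃ b → ladder n a ⊆ ladder n b
ladder-◃-⊆ (a<b , inj₁ even)  = ladder-even-⊆ even a<b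
ladder-◃-⊆ (_   , inj₂ 3+a≤b) = ladder-gap-⊆ 3+a≤b

◃-<-trans : ∀ {a b c} → a ◃ b → b < c → a ◃ c
◃-<-trans (a<b , inj₁ even)  b<c = ℕ.<-trans a<b b<c , inj₁ even
◃-<-trans (a<b , inj₂ 3+a≤b) b<c = ℕ.<-trans a<b b<c , inj₂ (ℕ.≤-trans 3+a≤b (ℕ.<⇒≤ b<c))

<-chain⇒◃ : ∀ {a b c d} → a < b → b < c → c < d → a ◃ d
<-chain⇒◃ a<b b<c c<d =
  ℕ.<-trans a<b (ℕ.<-trans b<c c<d) , inj₂ (ℕ.≤-trans (s≤s (ℕ.≤-trans (s≤s a<b) b<c)) c<d)

parity-≡∧<⇒2+≤ : ∀ {a b} → parity a ≡ parity b → a < b → 2 + a ≤ b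
parity-≡∧<⇒2+≤ {zero}        {suc zero}    ()
parity-≡∧<⇒2+≤ {zero}        {suc (suc b)} _  _ = s≤s (s≤s z≤n)
parity-≡∧<⇒2+≤ {suc zero}    {suc zero}    _  (s≤s ())
parity-≡∧<⇒2+≤ {suc zero}    {suc (suc zero)} ()
parity-≡∧<⇒2+≤ {suc zero}    {suc (suc (suc b))} _ _ = s≤s (s≤s (s≤s z≤n))
parity-≡∧<⇒2+≤ {suc (suc a)} {suc (suc b)} same (s≤s (s≤s a<b)) = s≤s (s≤s (parity-≡∧<⇒2+≤ same a<b))

-- The even one of a and b lies below c; if both are odd then a + 3 ≤ c.
◃-one-of-two : ∀ {a b c} → a < b → b < c → a ◃ c ⊎ b ◃ c
◃-one-of-two {a} {b} a<b b<c with parity b in parity-b | parity a in parity-a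
... | 0ℙ | _  = inj₂ (b<c , inj₁ refl)
... | 1ℙ | 0ℙ = inj₁ (ℕ.<-trans a<b b<c , inj₁ refl)
... | 1ℙ | 1ℙ = inj₁ (ℕ.<-trans a<b b<c ,
                      inj₂ (ℕ.≤-trans (s≤s (parity-≡∧<⇒2+≤ (trans parity-a (sym parity-b)) a<b)) b<c))

ladder-⋈ : ∀ {n a₁ a₂ b₁ b₂} → a₁ ◃ b₁ → a₂ ◃ b₁ → a₁ < a₂ → b₁ < b₂ → b₂ < 2 * n →
           IsCopy (⋈-map (ladder n a₁) (ladder n a₂) (ladder n b₁) (ladder n b₂))
ladder-⋈ {n} {b₂ = b₂} a₁◃b₁ a₂◃b₁ a₁<a₂ b₁<b₂ b₂<2n =
  ⋈-map-injective (distinct a₁<a₂ (ℕ.<⇒≤ a₂<b₂)) (distinct a₁<b₁ (ℕ.<⇒≤ b₁<b₂))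
                  (distinct a₁<b₂ ℕ.≤-refl) (distinct (proj₁ a₂◃b₁) (ℕ.<⇒≤ b₁<b₂))
                  (distinct a₂<b₂ ℕ.≤-refl) (distinct b₁<b₂ ℕ.≤-refl) ,
  ⋈-map-monotone {_≼_ = _⊆_} ⊆-refl (ladder-◃-⊆ a₁◃b₁) (ladder-◃-⊆ (◃-<-trans a₁◃b₁ b₁<b₂))
                                      (ladder-◃-⊆ a₂◃b₁) (ladder-◃-⊆ (◃-<-trans a₂◃b₁ b₁<b₂))
  where
  a₁<b₁ = proj₁ a₁◃b₁
  a₁<b₂ = ℕ.<-trans a₁<b₁ b₁<b₂
  a₂<b₂ = ℕ.<-trans (proj₁ a₂◃b₁) b₁<b₂
  distinct : ∀ {a b} → a < b → b ≤ b₂ → ladder n a ≢ ladder n b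
  distinct a<b b≤b₂ = ladder-injective a<b (ℕ.≤-<-trans b≤b₂ b₂<2n)

descending-ladder⇒⋈ : ∀ {P : Subset n → Set} as → AllPairs _>_ as → All (_< 2 * n) as →
                      All (P ∘ ladder n) as → 4 < length as → HasCopyIn P
descending-ladder⇒⋈ {P = P} (a₅ ∷ a₄ ∷ a₃ ∷ a₂ ∷ a₁ ∷ _)
  ((a₄<a₅ ∷ _) ∷ (a₃<a₄ ∷ _) ∷ (a₂<a₃ ∷ _) ∷ (a₁<a₂ ∷ _) ∷ _) (a₅<2n ∷ _)
  (Pa₅ ∷ Pa₄ ∷ Pa₃ ∷ Pa₂ ∷ Pa₁ ∷ _) _ with ◃-one-of-two a₂<a₃ a₃<a₄
... | inj₁ a₂◃a₄ =
  _ , ladder-⋈ (<-chain⇒◃ a₁<a₂ a₂<a₃ a₃<a₄) a₂◃a₄ a₁<a₂ a₄<a₅ a₅<2n , ⋈-map-∀ {P = P} Pa₁ Pa₂ Pa₄ Pa₅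
... | inj₂ a₃◃a₄ =
  _ , ladder-⋈ (<-chain⇒◃ a₁<a₂ a₂<a₃ a₃<a₄) a₃◃a₄ (ℕ.<-trans a₁<a₂ a₂<a₃) a₄<a₅ a₅<2n ,
  ⋈-map-∀ {P = P} Pa₁ Pa₃ Pa₄ Pa₅
descending-ladder⇒⋈ [] _ _ _ ()
descending-ladder⇒⋈ (_ ∷ []) _ _ _ (s≤s ())
descending-ladder⇒⋈ (_ ∷ _ ∷ []) _ _ _ (s≤s (s≤s ()))
descending-ladder⇒⋈ (_ ∷ _ ∷ _ ∷ []) _ _ _ (s≤s (s≤s (s≤s ())))
descending-ladder⇒⋈ (_ ∷ _ ∷ _ ∷ _ ∷ []) _ _ _ (s≤s (s≤s (s≤s (s≤s ()))))

ladder-Ramsey : t * 4 < 2 * n → BRProp t n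
ladder-Ramsey {t} {n} long c
  with k , many ← pigeonhole 4 (toℕ ∘ c ∘ ladder n) (downFrom (2 * n))
                    (All.applyDownFrom⁺₂ id _ (λ _ → toℕ<n _))
                    (subst (t * 4 <_) (sym (length-downFrom (2 * n))) long)
  with f , copy , coloured-k ← descending-ladder⇒⋈ {P = λ S → toℕ (c S) ≡ k}
         (filter (λ a → toℕ (c (ladder n a)) ≟ k) (downFrom (2 * n)))
         (AllPairs.filter⁺ _ (AllPairs.applyDownFrom⁺₁ id (2 * n) (λ j<i _ → j<i)))
         (All.filter⁺ _ (All.applyDownFrom⁺₁ id (2 * n) id))
         (All.all-filter _ (downFrom (2 * n)))
         many
  = f , copy , c (f x₁) , λ u → toℕ-injective (trans (coloured-k u) (sym (coloured-k x₁)))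

⌊m/2⌋<n : ∀ {m} n → m < 2 * n → ⌊ m /2⌋ < n
⌊m/2⌋<n {zero}        (suc n) _ = z<s
⌊m/2⌋<n {suc zero}    (suc n) _ = z<s
⌊m/2⌋<n {suc (suc m)} (suc n) 2+m<2+2n =
  s<s (⌊m/2⌋<n n (ℕ.+-cancelˡ-< 2 m (2 * n) (subst (2 + m <_) (ℕ.*-suc 2 n) 2+m<2+2n)))

⌊a/2⌋≡⌊b/2⌋∧a<b⇒b≡1+a : ∀ {a b} → ⌊ a /2⌋ ≡ ⌊ b /2⌋ → a < b → b ≡ suc a
⌊a/2⌋≡⌊b/2⌋∧a<b⇒b≡1+a {a} {b} same a<b with b ≤? suc a
... | yes b≤1+a = ℕ.≤-antisym b≤1+a a<b
... | no  b≰1+a = contradiction (subst (λ h → suc h ≤ ⌊ b /2⌋) same (ℕ.⌊n/2⌋-mono (ℕ.≰⇒> b≰1+a)))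
                                (ℕ.n≮n ⌊ b /2⌋)

⌊1+a/2⌋≡0⇒a≡0 : ∀ {a} → ⌊ suc a /2⌋ ≡ 0 → a ≡ 0
⌊1+a/2⌋≡0⇒a≡0 {zero} _ = refl

sizeColour : ℕ → ℕ → ℕ
sizeColour M s with s <? M
... | yes _ = ⌊ s /2⌋
... | no  _ = 0

module _ {M s : ℕ} where

  sizeColour-< : s < M → sizeColour M s ≡ ⌊ s /2⌋
  sizeColour-< s<M with s <? M
  ... | yes _   = refl
  ... | no  s≮M = contradiction s<M s≮M

  sizeColour-≮ : ¬ s < M → sizeColour M s ≡ 0
  sizeColour-≮ s≮M with s <? M
  ... | yes s<M = contradiction s<M s≮M
  ... | no  _   = refl

  sizeColour<t : 1 ≤ t → M ≤ 2 * t → sizeColour M s < t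
  sizeColour<t {t} 1≤t M≤2t with s <? M
  ... | yes s<M = ⌊m/2⌋<n t (ℕ.<-≤-trans s<M M≤2t)
  ... | no  _   = 1≤t

sizeColouring : ∀ {M} → 1 ≤ t → M ≤ 2 * t → Subset M → Fin t
sizeColouring 1≤t M≤2t S = fromℕ< (sizeColour<t {s = ∣ S ∣} 1≤t M≤2t)

same-sizeColour-below : ∀ {M a b} → a < b → b < M → sizeColour M a ≡ sizeColour M b → b ≡ suc a
same-sizeColour-below a<b b<M same =
  ⌊a/2⌋≡⌊b/2⌋∧a<b⇒b≡1+a
    (trans (sym (sizeColour-< (ℕ.<-trans a<b b<M))) (trans same (sizeColour-< b<M))) a<b

module _ {M j : ℕ} {f : Bfly → Subset M} (copy : IsCopy f)
         (coloured : ∀ u → sizeColour M ∣ f u ∣ ≡ j) where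

  private
    injective = proj₁ copy
    monotone  = proj₂ copy

  sizeColour-copy-step : ∀ {u v} → u ≤⋈ v → u ≢ v → ∣ f v ∣ < M → ∣ f v ∣ ≡ suc ∣ f u ∣
  sizeColour-copy-step u≤v u≢v fv<M =
    same-sizeColour-below (IsCopy⇒∣<∣ copy u≤v u≢v) fv<M (trans (coloured _) (sym (coloured _)))

  -- If f y₂ were on the top level, j would be 0, so f y₁ would be a singleton and both xᵢ empty.
  ⋈-below-top⇒below-top : ∣ f y₁ ∣ < M → ∣ f y₂ ∣ < M
  ⋈-below-top⇒below-top b₁<M with ∣ f y₂ ∣ <? M
  ... | yes b₂<M = b₂<M
  ... | no  b₂≮M =
    contradiction (injective (trans (∣p∣≡0⇒p≡⊥ (empty x₁y₁ λ ())) (sym (∣p∣≡0⇒p≡⊥ (empty x₂y₁ λ ())))))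
                  λ ()
    where
    ⌊b₁/2⌋≡0 : ⌊ ∣ f y₁ ∣ /2⌋ ≡ 0
    ⌊b₁/2⌋≡0 = trans (sym (sizeColour-< b₁<M))
                     (trans (coloured y₁) (trans (sym (coloured y₂)) (sizeColour-≮ b₂≮M)))
    empty : ∀ {u} → u ≤⋈ y₁ → u ≢ y₁ → ∣ f u ∣ ≡ 0
    empty u≤y₁ u≢y₁ =
      ⌊1+a/2⌋≡0⇒a≡0 (subst (λ b → ⌊ b /2⌋ ≡ 0) (sizeColour-copy-step u≤y₁ u≢y₁ b₁<M) ⌊b₁/2⌋≡0)

  ⋈-y₁-on-top : ¬ ∣ f y₁ ∣ < M
  ⋈-y₁-on-top b₁<M =
    [ (λ ()) ∘ injective , (λ ()) ∘ injective ]
      (⊆-adjacent-levels (monotone x₁y₁) (monotone x₁y₂) (monotone x₂y₁) (monotone x₂y₂)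
         refl (ℕ.suc-injective (trans (sym b₁≡1+a₂) b₁≡1+a₁)) b₁≡1+a₁
         (sizeColour-copy-step x₁y₂ (λ ()) (⋈-below-top⇒below-top b₁<M)))
    where
    b₁≡1+a₁ = sizeColour-copy-step x₁y₁ (λ ()) b₁<M
    b₁≡1+a₂ = sizeColour-copy-step x₂y₁ (λ ()) b₁<M

sizeColour-no-monochromatic-⋈ : ∀ {M j} {f : Bfly → Subset M} → IsCopy f →
                                ¬ (∀ u → sizeColour M ∣ f u ∣ ≡ j)
sizeColour-no-monochromatic-⋈ {M} {f = f} copy coloured =
  contradiction (proj₁ copy (trans (full (f y₁) (⋈-y₁-on-top copy coloured))
                                   (sym (full (f y₂) (⋈-y₁-on-top swapped (coloured ∘ ⋈-swap))))))
                λ ()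
  where
  swapped = IsCopy-∘-⋈-swap copy
  full : ∀ p → ¬ ∣ p ∣ < M → p ≡ ⊤
  full p ∣p∣≮M = ∣p∣≡n⇒p≡⊤ (ℕ.≤-antisym (∣p∣≤n p) (ℕ.≮⇒≥ ∣p∣≮M))

sizeColouring-no-monochromatic-⋈ : ∀ {M} (1≤t : 1 ≤ t) (M≤2t : M ≤ 2 * t) →
                                   ¬ HasMonoCopy (sizeColouring 1≤t M≤2t)
sizeColouring-no-monochromatic-⋈ 1≤t M≤2t (f , copy , k , coloured-k) =
  sizeColour-no-monochromatic-⋈ copy (λ u → trans (sym (toℕ-fromℕ< _)) (cong toℕ (coloured-k u)))

proposition2p8 : (t : ℕ) → 1 ≤ t → BR-is t (2 * t + 1)
proposition2p8 t 1≤t = ladder-Ramsey more-than-4t-positions , minimal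
  where
  2[2t+1]≡4t+2 : ∀ t → 2 * (2 * t + 1) ≡ t * 4 + 2
  2[2t+1]≡4t+2 = solve-∀
  more-than-4t-positions : t * 4 < 2 * (2 * t + 1)
  more-than-4t-positions = subst (t * 4 <_) (sym (2[2t+1]≡4t+2 t)) (ℕ.m<m+n (t * 4) z<s)
  minimal : ∀ N → BRProp t N → 2 * t + 1 ≤ N
  minimal N ramsey = ℕ.≮⇒≥ λ N<2t+1 →
    let N≤2t = ℕ.m<1+n⇒m≤n (subst (N <_) (ℕ.+-comm (2 * t) 1) N<2t+1)
    in sizeColouring-no-monochromatic-⋈ 1≤t N≤2t (ramsey (sizeColouring 1≤t N≤2t))
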